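{- Let $G$ be a finite simple bipartite graph, let $\widehat S$ be a local maximum stable set of $G$, and let $\widehat M$ be a maximum matching in the induced subgraph $G[N[\widehat S]]$. Then there exists a maximum matching $M$ of $G$ with $\widehat M\subseteq M$.
   Context: For $A\subseteq V(G)$, $N(A)=\{v\in V(G)-A: v \text{ has a neighbor in } A\}$ and $N[A]=A\cup N(A)$. A set $A$ is a local maximum stable set of $G$ if $A$ is a stable set (pairwise non-adjacent vertices) of maximum cardinality in the induced subgraph $G[N[A]]$. -}

module Defs where

open import Data.Nat using (ℕ; _≤_)
open import Data.Bool using (Bool; true; false; T)
open import Data.Fin using (Fin)
open import Data.Fin.Subset using (Subset; _∈_; _∉_; ∣_∣; _⊆_)
open import Data.Product using (Σ; _×_; _,_; ∃)
open import Data.Sum using (_⊎_)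
open import Data.List using (List; length; map; concat; _∷_; [])
open import Data.List.Relation.Unary.All using (All)
open import Data.List.Relation.Unary.Unique.Propositional using (Unique)
import Data.List.Membership.Propositional as LM
open import Relation.Binary.PropositionalEquality using (_≡_)
open import Relation.Nullary using (¬_)
open import Data.Unit using (⊤)

record Graph (n : ℕ) : Set where
  field
    adj   : Fin n → Fin n → Bool
    sym   : ∀ u v → adj u v ≡ adj v u
    irr   : ∀ v → adj v v ≡ false

open Graph public

Adj : ∀ {n} → Graph n → Fin n → Fin n → Set
Adj G u v = T (adj G u v)

Bipartite : ∀ {n} → Graph n → Set
Bipartite {n} G = Σ (Fin n → Bool) λ c → ∀ u v → Adj G u v → ¬ (c u ≡ c v)

Stable : ∀ {n} → Graph n → Subset n → Set
Stable G S = ∀ u v → u ∈ S → v ∈ S → ¬ Adj G u v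

ClosedNbhd : ∀ {n} → Graph n → Subset n → Fin n → Set
ClosedNbhd G A v = v ∈ A ⊎ ∃ λ u → u ∈ A × Adj G u v

-- A is a maximum stable set of the induced subgraph G[N[A]]:
-- A is stable, A ⊆ N[A] trivially, and every stable set of G[N[A]]
-- (a stable set of G all of whose vertices lie in N[A]) has size ≤ |A|.
LocalMaxStable : ∀ {n} → Graph n → Subset n → Set
LocalMaxStable {n} G A =
  Stable G A ×
  (∀ (T' : Subset n) → (∀ v → v ∈ T' → ClosedNbhd G A v) → Stable G T' → ∣ T' ∣ ≤ ∣ A ∣)

Edge : ℕ → Set
Edge n = Fin n × Fin n

endpoints : ∀ {n} → List (Edge n) → List (Fin n)
endpoints [] = []
endpoints ((u , v) ∷ es) = u ∷ v ∷ endpoints es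

-- A matching of G all of whose vertices satisfy P (the induced subgraph G[P]):
-- every listed pair is an edge with both ends in P, and all endpoints are
-- distinct (so edges are pairwise disjoint, and no edge is listed twice).
MatchingIn : ∀ {n} → Graph n → (Fin n → Set) → List (Edge n) → Set
MatchingIn G P M =
  All (λ e → Adj G (Data.Product.proj₁ e) (Data.Product.proj₂ e)
           × P (Data.Product.proj₁ e) × P (Data.Product.proj₂ e)) M
  × Unique (endpoints M)

AllV : ∀ {n} → Fin n → Set
AllV _ = ⊤

MaxMatchingIn : ∀ {n} → Graph n → (Fin n → Set) → List (Edge n) → Set
MaxMatchingIn G P M =
  MatchingIn G P M × (∀ M' → MatchingIn G P M' → length M' ≤ length M)

_∈E_ : ∀ {n} → Edge n → List (Edge n) → Set
(u , v) ∈E M = (u , v) LM.∈ M ⊎ (v , u) LM.∈ M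

_⊆E_ : ∀ {n} → List (Edge n) → List (Edge n) → Set
M̂ ⊆E M = All (λ e → e ∈E M) M̂

-- Let N(S) be the set of neighbours of S outside S. For a stable A ⊆ N(S), the set
-- A ∪ (S ∖ N(A)) is stable and lies in N[S], so local maximality of S gives |A| ≤ |N(A) ∩ S|.
-- In a bipartite graph every A ⊆ N(S) splits into two stable colour classes whose
-- neighbourhoods in S are disjoint, so Hall's condition holds and N(S) can be matched into S:
-- G[N[S]] has a matching of size |N(S)|, hence |M̂| ≥ |N(S)|. Now take any maximum matching M
-- of G. Since S is stable, each edge of M touching N[S] has an end in N(S), so at most
-- |N(S)| ≤ |M̂| edges of M touch N[S]; replacing them by M̂ gives a matching at least as large
-- as M, hence a maximum one, that contains M̂.
{-# OPTIONS --safe #-}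
module Submission where

open import Defs hiding (sym)

open import Data.Bool using (Bool; true; false; T; T?; _≟_)
open import Data.Bool.Properties using (¬-not)
open import Data.Fin using (Fin; zero; suc)
import Data.Fin.Properties as Fin
open import Data.Fin.Subset
  using (Subset; inside; outside; _∈_; _∉_; _⊆_; _⊂_; _∪_; _∩_; _─_; _-_; ⁅_⁆; ∁; ∣_∣; ⊤; Nonempty; Empty)
open import Data.Fin.Subset.Properties
  using ( _∈?_; _⊂?_; nonempty?; anySubset?; Empty-unique; ∣⊥∣≡0; ∈⊤; ∣⊤∣≡n; ⊆-trans; p⊆q⇒∣p∣≤∣q∣
        ; x∈⁅x⁆; x∈⁅y⁆⇒x≡y; ∣⁅x⁆∣≡1; x∈∁p⇒x∉p; x∉p⇒x∈∁p
        ; x∈p∪q⁺; x∈p∪q⁻; x∈p∩q⁺; x∈p∩q⁻; p∩q⊆p; ∣p∩q∣≤∣q∣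
        ; x∈p∧x∉q⇒x∈p─q; p─q⊆p; p∩q≢∅⇒p─q⊂p; x∈p∧x≢y⇒x∈p-y; x∈p⇒p-x⊂p; x∈p⇒∣p-x∣<∣p∣ )
open import Data.Fin.Subset.Induction using (Acc; acc; ⊂-wellFounded)
open import Data.List using (List; []; _∷_; length; map; filter; _++_)
open import Data.List.Properties using (length-map; length-++)
open import Data.List.Membership.Propositional.Properties using (∈-++⁺ˡ)
open import Data.List.Relation.Binary.Disjoint.Propositional using (Disjoint)
import Data.List.Relation.Binary.Sublist.Propositional as Sublist
open import Data.List.Relation.Binary.Sublist.Propositional using ([]; _∷_; _∷ʳ_)
open import Data.List.Relation.Binary.Sublist.Propositional.Properties using (All-resp-⊆; filter-⊆)
open import Data.List.Relation.Unary.All using (All; []; _∷_)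
import Data.List.Relation.Unary.All as All
import Data.List.Relation.Unary.All.Properties as All
open import Data.List.Relation.Unary.All.Properties using (all-filter)
open import Data.List.Relation.Unary.AllPairs using ([]; _∷_)
open import Data.List.Relation.Unary.Unique.Propositional using (Unique)
import Data.List.Relation.Unary.Unique.Propositional.Properties as Unique
import Data.List.Relation.Unary.Unique.DecPropositional as UniqueDec
open import Data.Nat using (ℕ; zero; suc; _+_; _≤_; _<_; z≤n; s≤s; _≤?_)
open import Data.Nat.Properties
  using ( ≤-reflexive; ≤-trans; ≤-<-trans; ≤-pred; n≤1+n; ≤∧≢⇒<; ≰⇒>; >⇒≢; suc-injective
        ; +-comm; +-suc; +-mono-≤; +-monoˡ-≤; +-monoʳ-≤; +-cancelˡ-≤; +-cancelʳ-≤; module ≤-Reasoning )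
open import Data.Product using (Σ; ∃; ∄; _×_; _,_; proj₁; proj₂)
open import Data.Sum using (_⊎_; inj₁; inj₂)
import Data.Sum as Sum
open import Data.Unit using (tt)
open import Data.Vec using ([]; _∷_; tabulate; here; there)
open import Data.Vec.Properties using (lookup∘tabulate; []=⇒lookup; lookup⇒[]=)
open import Function using (_∘_)
open import Level using (0ℓ)
open import Relation.Binary.Definitions using (_Respects_)
open import Relation.Binary.PropositionalEquality using (_≡_; _≢_; refl; sym; trans; cong; subst; ≢-sym)
open import Relation.Nullary using (¬_; ¬?; Dec; yes; no; does; contradiction)
open import Relation.Nullary.Decidable using (dec-true; map′; _×-dec_; _⊎-dec_)
open import Relation.Unary using (Pred; Decidable)

private
  variable
    n : ℕ

∣p∪q∣≤∣p∣+∣q∣ : ∀ (p q : Subset n) → ∣ p ∪ q ∣ ≤ ∣ p ∣ + ∣ q ∣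
∣p∪q∣≤∣p∣+∣q∣ []            []            = z≤n
∣p∪q∣≤∣p∣+∣q∣ (inside ∷ p)  (inside ∷ q)  = s≤s (≤-trans (∣p∪q∣≤∣p∣+∣q∣ p q) (+-monoʳ-≤ ∣ p ∣ (n≤1+n ∣ q ∣)))
∣p∪q∣≤∣p∣+∣q∣ (inside ∷ p)  (outside ∷ q) = s≤s (∣p∪q∣≤∣p∣+∣q∣ p q)
∣p∪q∣≤∣p∣+∣q∣ (outside ∷ p) (inside ∷ q)  = ≤-trans (s≤s (∣p∪q∣≤∣p∣+∣q∣ p q)) (≤-reflexive (sym (+-suc ∣ p ∣ ∣ q ∣)))
∣p∪q∣≤∣p∣+∣q∣ (outside ∷ p) (outside ∷ q) = ∣p∪q∣≤∣p∣+∣q∣ p q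

∣p∪q∣≡∣p∣+∣q∣ : ∀ (p q : Subset n) → (∀ {x} → x ∈ p → x ∉ q) → ∣ p ∪ q ∣ ≡ ∣ p ∣ + ∣ q ∣
∣p∪q∣≡∣p∣+∣q∣ []            []            _        = refl
∣p∪q∣≡∣p∣+∣q∣ (inside ∷ p)  (inside ∷ q)  disjoint = contradiction here (disjoint here)
∣p∪q∣≡∣p∣+∣q∣ (inside ∷ p)  (outside ∷ q) disjoint =
  cong suc (∣p∪q∣≡∣p∣+∣q∣ p q (λ x∈p x∈q → disjoint (there x∈p) (there x∈q)))
∣p∪q∣≡∣p∣+∣q∣ (outside ∷ p) (inside ∷ q)  disjoint =
  trans (cong suc (∣p∪q∣≡∣p∣+∣q∣ p q (λ x∈p x∈q → disjoint (there x∈p) (there x∈q)))) (sym (+-suc ∣ p ∣ ∣ q ∣))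
∣p∪q∣≡∣p∣+∣q∣ (outside ∷ p) (outside ∷ q) disjoint =
  ∣p∪q∣≡∣p∣+∣q∣ p q (λ x∈p x∈q → disjoint (there x∈p) (there x∈q))

∣p∣≡∣p∩q∣+∣p─q∣ : ∀ (p q : Subset n) → ∣ p ∣ ≡ ∣ p ∩ q ∣ + ∣ p ─ q ∣
∣p∣≡∣p∩q∣+∣p─q∣ []            []            = refl
∣p∣≡∣p∩q∣+∣p─q∣ (inside ∷ p)  (inside ∷ q)  = cong suc (∣p∣≡∣p∩q∣+∣p─q∣ p q)
∣p∣≡∣p∩q∣+∣p─q∣ (inside ∷ p)  (outside ∷ q) = trans (cong suc (∣p∣≡∣p∩q∣+∣p─q∣ p q)) (sym (+-suc ∣ p ∩ q ∣ ∣ p ─ q ∣))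
∣p∣≡∣p∩q∣+∣p─q∣ (outside ∷ p) (inside ∷ q)  = ∣p∣≡∣p∩q∣+∣p─q∣ p q
∣p∣≡∣p∩q∣+∣p─q∣ (outside ∷ p) (outside ∷ q) = ∣p∣≡∣p∩q∣+∣p─q∣ p q

x∈p─q⇒x∉q : ∀ {p q : Subset n} {x} → x ∈ p ─ q → x ∉ q
x∈p─q⇒x∉q {p = inside ∷ p} {outside ∷ q} here        ()
x∈p─q⇒x∉q {p = _ ∷ p}      {_ ∷ q}       (there x∈) (there x∈q) = x∈p─q⇒x∉q {p = p} x∈ x∈q

p⊆r∧q⊆r⇒p∪q⊆r : ∀ (p q : Subset n) {r} → p ⊆ r → q ⊆ r → p ∪ q ⊆ r
p⊆r∧q⊆r⇒p∪q⊆r p q p⊆r q⊆r x∈p∪q = Sum.[ p⊆r , q⊆r ] (x∈p∪q⁻ p q x∈p∪q)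

x∈p⇒⁅x⁆⊆p : ∀ {p : Subset n} {x} → x ∈ p → ⁅ x ⁆ ⊆ p
x∈p⇒⁅x⁆⊆p {p = p} {x} x∈p y∈⁅x⁆ = subst (_∈ p) (sym (x∈⁅y⁆⇒x≡y x y∈⁅x⁆)) x∈p

∣p∣>0⇒Nonempty : ∀ (p : Subset n) → 0 < ∣ p ∣ → Nonempty p
∣p∣>0⇒Nonempty {n} p 0<∣p∣ with nonempty? p
... | yes p≢∅ = p≢∅
... | no  p≡∅ = contradiction (trans (cong ∣_∣ (Empty-unique p≡∅)) (∣⊥∣≡0 n)) (>⇒≢ 0<∣p∣)

⟦_⟧ : ∀ {ℓ} {P : Pred (Fin n) ℓ} → Decidable P → Subset n
⟦ P? ⟧ = tabulate (λ x → does (P? x))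

module _ {ℓ} {P : Pred (Fin n) ℓ} (P? : Decidable P) where

  ∈⟦⟧⁺ : ∀ {x} → P x → x ∈ ⟦ P? ⟧
  ∈⟦⟧⁺ {x} px = lookup⇒[]= x ⟦ P? ⟧ (trans (lookup∘tabulate _ x) (dec-true (P? x) px))

  ∈⟦⟧⁻ : ∀ {x} → x ∈ ⟦ P? ⟧ → P x
  ∈⟦⟧⁻ {x} x∈ with P? x | trans (sym (lookup∘tabulate _ x)) ([]=⇒lookup x∈)
  ... | yes px | _  = px
  ... | no  _  | ()

elements : Subset n → List (Fin n)
elements []            = []
elements (inside ∷ p)  = zero ∷ map suc (elements p)
elements (outside ∷ p) = map suc (elements p)

length-elements : ∀ (p : Subset n) → length (elements p) ≡ ∣ p ∣
length-elements []            = refl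
length-elements (inside ∷ p)  = cong suc (trans (length-map suc (elements p)) (length-elements p))
length-elements (outside ∷ p) = trans (length-map suc (elements p)) (length-elements p)

elements⊆ : ∀ (p : Subset n) → All (_∈ p) (elements p)
elements⊆ []            = []
elements⊆ (inside ∷ p)  = here ∷ All.map⁺ (All.map there (elements⊆ p))
elements⊆ (outside ∷ p) = All.map⁺ (All.map there (elements⊆ p))

elements-unique : ∀ (p : Subset n) → Unique (elements p)
elements-unique []            = []
elements-unique (inside ∷ p)  =
  All.map⁺ (All.universal (λ _ ()) (elements p)) ∷ Unique.map⁺ Fin.suc-injective (elements-unique p)
elements-unique (outside ∷ p) = Unique.map⁺ Fin.suc-injective (elements-unique p)

module Hall {n} {R : Fin n → Fin n → Set} (R? : ∀ x y → Dec (R x y)) where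

  Neighbour : Subset n → Subset n → Pred (Fin n) 0ℓ
  Neighbour Y A y = y ∈ Y × ∃ λ x → x ∈ A × R x y

  neighbour? : ∀ Y A → Decidable (Neighbour Y A)
  neighbour? Y A y = y ∈? Y ×-dec Fin.any? (λ x → x ∈? A ×-dec R? x y)

  neighbours : Subset n → Subset n → Subset n
  neighbours Y A = ⟦ neighbour? Y A ⟧

  ∈neighbours⁺ : ∀ {Y A x y} → y ∈ Y → x ∈ A → R x y → y ∈ neighbours Y A
  ∈neighbours⁺ {Y} {A} y∈Y x∈A Rxy = ∈⟦⟧⁺ (neighbour? Y A) (y∈Y , _ , x∈A , Rxy)

  ∈neighbours⁻ : ∀ {Y A y} → y ∈ neighbours Y A → Neighbour Y A y
  ∈neighbours⁻ {Y} {A} = ∈⟦⟧⁻ (neighbour? Y A)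

  neighbours⊆ : ∀ Y A → neighbours Y A ⊆ Y
  neighbours⊆ Y A y∈ = proj₁ (∈neighbours⁻ y∈)

  neighbours-mono : ∀ {Y A B} → A ⊆ B → neighbours Y A ⊆ neighbours Y B
  neighbours-mono A⊆B y∈ with y∈Y , x , x∈A , Rxy ← ∈neighbours⁻ y∈ = ∈neighbours⁺ y∈Y (A⊆B x∈A) Rxy

  neighbours-∪ : ∀ Y A B → neighbours Y (A ∪ B) ⊆ neighbours Y A ∪ neighbours (Y ─ neighbours Y A) B
  neighbours-∪ Y A B {y} y∈ with ∈neighbours⁻ y∈ | y ∈? neighbours Y A
  ... | _                       | yes y∈NA = x∈p∪q⁺ (inj₁ y∈NA)
  ... | y∈Y , x , x∈A∪B , Rxy | no  y∉NA with x∈p∪q⁻ A B x∈A∪B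
  ...   | inj₁ x∈A = contradiction (∈neighbours⁺ y∈Y x∈A Rxy) y∉NA
  ...   | inj₂ x∈B = x∈p∪q⁺ (inj₂ (∈neighbours⁺ (x∈p∧x∉q⇒x∈p─q y∈Y y∉NA) x∈B Rxy))

  neighbours-remove : ∀ Y A y → neighbours Y A ⊆ neighbours (Y - y) A ∪ ⁅ y ⁆
  neighbours-remove Y A y {z} z∈ with z Fin.≟ y
  ... | yes refl = x∈p∪q⁺ (inj₂ (x∈⁅x⁆ y))
  ... | no  z≢y with z∈Y , x , x∈A , Rxz ← ∈neighbours⁻ z∈ =
    x∈p∪q⁺ (inj₁ (∈neighbours⁺ (x∈p∧x≢y⇒x∈p-y z∈Y z≢y) x∈A Rxz))

  -- System of distinct representatives of X in Y; rep is junk outside X.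
  record SDR (X Y : Subset n) : Set where
    field
      rep           : Fin n → Fin n
      rep∈          : ∀ {x} → x ∈ X → rep x ∈ Y
      R-rep         : ∀ {x} → x ∈ X → R x (rep x)
      rep-injective : ∀ {x x′} → x ∈ X → x′ ∈ X → rep x ≡ rep x′ → x ≡ x′

  SDR-∅ : ∀ {X Y} → Empty X → SDR X Y
  SDR-∅ X≡∅ = record
    { rep           = λ x → x
    ; rep∈          = λ x∈X → contradiction (_ , x∈X) X≡∅
    ; R-rep         = λ x∈X → contradiction (_ , x∈X) X≡∅
    ; rep-injective = λ x∈X _ _ → contradiction (_ , x∈X) X≡∅
    }

  SDR-singleton : ∀ {x y} → R x y → SDR ⁅ x ⁆ ⁅ y ⁆
  SDR-singleton {x} {y} Rxy = record
    { rep           = λ _ → y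
    ; rep∈          = λ _ → x∈⁅x⁆ y
    ; R-rep         = λ x′∈ → subst (λ z → R z y) (sym (x∈⁅y⁆⇒x≡y x x′∈)) Rxy
    ; rep-injective = λ x₁∈ x₂∈ _ → trans (x∈⁅y⁆⇒x≡y x x₁∈) (sym (x∈⁅y⁆⇒x≡y x x₂∈))
    }

  SDR-neighbours : ∀ {A Y} → SDR A Y → SDR A (neighbours Y A)
  SDR-neighbours s = record
    { rep           = rep
    ; rep∈          = λ x∈A → ∈neighbours⁺ (rep∈ x∈A) x∈A (R-rep x∈A)
    ; R-rep         = R-rep
    ; rep-injective = rep-injective
    }
    where open SDR s

  SDR-split : ∀ {X A Y Y₁} → Y₁ ⊆ Y → SDR A Y₁ → SDR (X ─ A) (Y ─ Y₁) → SDR X Y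
  SDR-split {X} {A} {Y} {Y₁} Y₁⊆Y s₁ s₂ = record
    { rep = rep ; rep∈ = rep∈ ; R-rep = R-rep ; rep-injective = rep-injective }
    where
    module s₁ = SDR s₁
    module s₂ = SDR s₂

    rep : Fin n → Fin n
    rep x with x ∈? A
    ... | yes _ = s₁.rep x
    ... | no  _ = s₂.rep x

    rep∈ : ∀ {x} → x ∈ X → rep x ∈ Y
    rep∈ {x} x∈X with x ∈? A
    ... | yes x∈A = Y₁⊆Y (s₁.rep∈ x∈A)
    ... | no  x∉A = p─q⊆p Y Y₁ (s₂.rep∈ (x∈p∧x∉q⇒x∈p─q x∈X x∉A))

    R-rep : ∀ {x} → x ∈ X → R x (rep x)
    R-rep {x} x∈X with x ∈? A
    ... | yes x∈A = s₁.R-rep x∈A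
    ... | no  x∉A = s₂.R-rep (x∈p∧x∉q⇒x∈p─q x∈X x∉A)

    separated : ∀ {x x′} → x ∈ A → x′ ∈ X ─ A → s₁.rep x ≢ s₂.rep x′
    separated x∈A x′∈X─A eq = x∈p─q⇒x∉q (s₂.rep∈ x′∈X─A) (subst (_∈ Y₁) eq (s₁.rep∈ x∈A))

    rep-injective : ∀ {x x′} → x ∈ X → x′ ∈ X → rep x ≡ rep x′ → x ≡ x′
    rep-injective {x} {x′} x∈X x′∈X with x ∈? A | x′ ∈? A
    ... | yes x∈A | yes x′∈A = s₁.rep-injective x∈A x′∈A
    ... | no  x∉A | no  x′∉A = s₂.rep-injective (x∈p∧x∉q⇒x∈p─q x∈X x∉A) (x∈p∧x∉q⇒x∈p─q x′∈X x′∉A)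
    ... | yes x∈A | no  x′∉A = λ eq → contradiction eq (separated x∈A (x∈p∧x∉q⇒x∈p─q x′∈X x′∉A))
    ... | no  x∉A | yes x′∈A = λ eq → contradiction (sym eq) (separated x′∈A (x∈p∧x∉q⇒x∈p─q x∈X x∉A))

  HallCondition : Subset n → Subset n → Set
  HallCondition X Y = ∀ A → A ⊆ X → ∣ A ∣ ≤ ∣ neighbours Y A ∣

  Tight : Subset n → Subset n → Pred (Subset n) 0ℓ
  Tight X Y A = A ⊂ X × Nonempty A × ∣ neighbours Y A ∣ ≤ ∣ A ∣

  tight? : ∀ X Y → Decidable (Tight X Y)
  tight? X Y A = A ⊂? X ×-dec nonempty? A ×-dec ∣ neighbours Y A ∣ ≤? ∣ A ∣

  HallCondition-⊆ : ∀ {A X Y} → A ⊆ X → HallCondition X Y → HallCondition A Y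
  HallCondition-⊆ A⊆X hall B B⊆A = hall B (⊆-trans B⊆A A⊆X)

  has-neighbour : ∀ {X Y x} → HallCondition X Y → x ∈ X → ∃ λ y → y ∈ Y × R x y
  has-neighbour {X} {Y} {x} hall x∈X
    with y , y∈N ← ∣p∣>0⇒Nonempty (neighbours Y ⁅ x ⁆)
                     (subst (_≤ ∣ neighbours Y ⁅ x ⁆ ∣) (∣⁅x⁆∣≡1 x) (hall ⁅ x ⁆ (x∈p⇒⁅x⁆⊆p x∈X)))
    with y∈Y , x′ , x′∈⁅x⁆ , Rx′y ← ∈neighbours⁻ y∈N
    = y , y∈Y , subst (λ z → R z y) (x∈⁅y⁆⇒x≡y x x′∈⁅x⁆) Rx′y

  HallCondition-─tight : ∀ {A X Y} → A ⊆ X → ∣ neighbours Y A ∣ ≤ ∣ A ∣ →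
                         HallCondition X Y → HallCondition (X ─ A) (Y ─ neighbours Y A)
  HallCondition-─tight {A} {X} {Y} A⊆X tight hall B B⊆X─A = +-cancelˡ-≤ ∣ A ∣ ∣ B ∣ _ (begin
    ∣ A ∣ + ∣ B ∣                    ≡⟨ sym (∣p∪q∣≡∣p∣+∣q∣ A B (λ x∈A x∈B → x∈p─q⇒x∉q (B⊆X─A x∈B) x∈A)) ⟩
    ∣ A ∪ B ∣                        ≤⟨ hall (A ∪ B) (p⊆r∧q⊆r⇒p∪q⊆r A B A⊆X (p─q⊆p X A ∘ B⊆X─A)) ⟩
    ∣ neighbours Y (A ∪ B) ∣         ≤⟨ p⊆q⇒∣p∣≤∣q∣ (neighbours-∪ Y A B) ⟩
    ∣ neighbours Y A ∪ N′ B ∣        ≤⟨ ∣p∪q∣≤∣p∣+∣q∣ (neighbours Y A) (N′ B) ⟩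
    ∣ neighbours Y A ∣ + ∣ N′ B ∣    ≤⟨ +-monoˡ-≤ ∣ N′ B ∣ tight ⟩
    ∣ A ∣ + ∣ N′ B ∣                 ∎)
    where
    open ≤-Reasoning
    N′ : Subset n → Subset n
    N′ = neighbours (Y ─ neighbours Y A)

  HallCondition-remove : ∀ {X Y x} y → x ∈ X → ∄ (Tight X Y) → HallCondition (X - x) (Y - y)
  HallCondition-remove {X} {Y} {x} y x∈X no-tight B B⊆X-x with nonempty? B
  ... | no  B≡∅ = ≤-trans (≤-reflexive (trans (cong ∣_∣ (Empty-unique B≡∅)) (∣⊥∣≡0 n))) z≤n
  ... | yes B≢∅ = +-cancelʳ-≤ 1 ∣ B ∣ _ (begin
    ∣ B ∣ + 1                                  ≡⟨ +-comm ∣ B ∣ 1 ⟩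
    suc ∣ B ∣                                  ≤⟨ ≰⇒> (λ tight → no-tight (B , B⊂X , B≢∅ , tight)) ⟩
    ∣ neighbours Y B ∣                         ≤⟨ p⊆q⇒∣p∣≤∣q∣ (neighbours-remove Y B y) ⟩
    ∣ neighbours (Y - y) B ∪ ⁅ y ⁆ ∣           ≤⟨ ∣p∪q∣≤∣p∣+∣q∣ (neighbours (Y - y) B) ⁅ y ⁆ ⟩
    ∣ neighbours (Y - y) B ∣ + ∣ ⁅ y ⁆ ∣       ≡⟨ cong (∣ neighbours (Y - y) B ∣ +_) (∣⁅x⁆∣≡1 y) ⟩
    ∣ neighbours (Y - y) B ∣ + 1               ∎)
    where
    open ≤-Reasoning
    B⊂X : B ⊂ X
    B⊂X = p─q⊆p X ⁅ x ⁆ ∘ B⊆X-x , x , x∈X , λ x∈B → x∈p─q⇒x∉q (B⊆X-x x∈B) (x∈⁅x⁆ x)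

  -- Either a nonempty proper A ⊂ X is tight, and X splits into A and X ─ A, or every such A
  -- has a surplus neighbour, and any x ∈ X can be matched to any neighbour y.
  hall-rec : ∀ {X Y} → Acc _⊂_ X → HallCondition X Y → SDR X Y
  hall-rec {X} {Y} (acc smaller) hall with nonempty? X | anySubset? (tight? X Y)
  ... | no X≡∅ | _ = SDR-∅ X≡∅
  ... | yes _ | yes (A , A⊂X@(A⊆X , _) , (a , a∈A) , tight) =
    SDR-split (neighbours⊆ Y A)
      (SDR-neighbours (hall-rec (smaller A⊂X) (HallCondition-⊆ A⊆X hall)))
      (hall-rec (smaller (p∩q≢∅⇒p─q⊂p X A (a , x∈p∩q⁺ (A⊆X a∈A , a∈A))))
                (HallCondition-─tight A⊆X tight hall))
  ... | yes (x , x∈X) | no no-tight with y , y∈Y , Rxy ← has-neighbour hall x∈X =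
    SDR-split (x∈p⇒⁅x⁆⊆p y∈Y)
      (SDR-singleton Rxy)
      (hall-rec (smaller (x∈p⇒p-x⊂p x∈X)) (HallCondition-remove y x∈X no-tight))

  hall : ∀ {X Y} → HallCondition X Y → SDR X Y
  hall {X} = hall-rec (⊂-wellFounded X)

Touches : Pred (Fin n) 0ℓ → Pred (Edge n) 0ℓ
Touches P (u , v) = P u ⊎ P v

module _ {P : Pred (Fin n) 0ℓ} where

  All-endpoints⁺ : ∀ {M} → All (λ e → P (proj₁ e) × P (proj₂ e)) M → All P (endpoints M)
  All-endpoints⁺ []               = []
  All-endpoints⁺ ((pu , pv) ∷ ps) = pu ∷ pv ∷ All-endpoints⁺ ps

  All-endpoints⁻ : ∀ M → All P (endpoints M) → All (λ e → P (proj₁ e) × P (proj₂ e)) M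
  All-endpoints⁻ []      []             = []
  All-endpoints⁻ (_ ∷ M) (pu ∷ pv ∷ ps) = (pu , pv) ∷ All-endpoints⁻ M ps

endpoints-++ : ∀ (M M′ : List (Edge n)) → endpoints (M ++ M′) ≡ endpoints M ++ endpoints M′
endpoints-++ []            M′ = refl
endpoints-++ ((u , v) ∷ M) M′ = cong (λ vs → u ∷ v ∷ vs) (endpoints-++ M M′)

endpoints-⊆ : ∀ {M M′ : List (Edge n)} → M Sublist.⊆ M′ → endpoints M Sublist.⊆ endpoints M′
endpoints-⊆ []                = []
endpoints-⊆ ((u , v) ∷ʳ M⊆M′) = u ∷ʳ v ∷ʳ endpoints-⊆ M⊆M′
endpoints-⊆ (refl ∷ M⊆M′)     = refl ∷ refl ∷ endpoints-⊆ M⊆M′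

Unique-resp-⊆ : ∀ {A : Set} → Unique {A = A} Respects Sublist._⊇_
Unique-resp-⊆ []             []          = []
Unique-resp-⊆ (_ ∷ʳ xs⊆ys)   (_ ∷ uniq)  = Unique-resp-⊆ xs⊆ys uniq
Unique-resp-⊆ (refl ∷ xs⊆ys) (y∉ ∷ uniq) = All-resp-⊆ xs⊆ys y∉ ∷ Unique-resp-⊆ xs⊆ys uniq

length-filter+length-filter-∁ : ∀ {A : Set} {P : Pred A 0ℓ} (P? : Decidable P) xs →
  length (filter P? xs) + length (filter (¬? ∘ P?) xs) ≡ length xs
length-filter+length-filter-∁ P? []       = refl
length-filter+length-filter-∁ P? (x ∷ xs) with P? x
... | yes _ = cong suc (length-filter+length-filter-∁ P? xs)
... | no  _ = trans (+-suc (length (filter P? xs)) _) (cong suc (length-filter+length-filter-∁ P? xs))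

Touches-remove : ∀ {X : Subset n} {w} e → (w ≢ proj₁ e × w ≢ proj₂ e) × Touches (_∈ X) e → Touches (_∈ X - w) e
Touches-remove (u , v) ((w≢u , w≢v) , touch) =
  Sum.map (λ u∈X → x∈p∧x≢y⇒x∈p-y u∈X (≢-sym w≢u)) (λ v∈X → x∈p∧x≢y⇒x∈p-y v∈X (≢-sym w≢v)) touch

length≤∣cover∣ : ∀ (X : Subset n) M → Unique (endpoints M) → All (Touches (_∈ X)) M → length M ≤ ∣ X ∣
length≤∣cover∣ X []            _                          _                 = z≤n
length≤∣cover∣ X ((u , v) ∷ M) ((_ ∷ u∉M) ∷ v∉M ∷ unique) (touch ∷ touches) =
  Sum.[ (λ u∈X → remove u∈X u∉M) , (λ v∈X → remove v∈X v∉M) ] touch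
  where
  remove : ∀ {w} → w ∈ X → All (w ≢_) (endpoints M) → suc (length M) ≤ ∣ X ∣
  remove w∈X w∉M = ≤-<-trans
    (length≤∣cover∣ (X - _) M unique (All.zipWith (Touches-remove _) (All-endpoints⁻ M w∉M , touches)))
    (x∈p⇒∣p-x∣<∣p∣ w∈X)

module _ {A : Set} (search : ∀ {Q : Pred A 0ℓ} → Decidable Q → Dec (∃ Q)) where

  ∃-ofLength? : ∀ {P : Pred (List A) 0ℓ} → Decidable P → ∀ k → Dec (∃ λ xs → length xs ≡ k × P xs)
  ∃-ofLength? P? zero    = map′ (λ p → [] , refl , p) (λ { ([] , _ , p) → p ; (_ ∷ _ , () , _) }) (P? [])
  ∃-ofLength? P? (suc k) = map′ (λ (x , xs , eq , p) → x ∷ xs , cong suc eq , p)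
                                (λ { ([] , () , _) ; (x ∷ xs , eq , p) → x , xs , suc-injective eq , p })
                                (search (λ x → ∃-ofLength? (P? ∘ (x ∷_)) k))

  longest : ∀ {P : Pred (List A) 0ℓ} → Decidable P → P [] → ∀ m → (∀ xs → P xs → length xs ≤ m) →
            ∃ λ xs → P xs × (∀ ys → P ys → length ys ≤ length xs)
  longest P? p[] zero    bound = [] , p[] , bound
  longest P? p[] (suc m) bound with ∃-ofLength? P? (suc m)
  ... | yes (xs , eq , p) = xs , p , λ ys q → subst (length ys ≤_) (sym eq) (bound ys q)
  ... | no  none          = longest P? p[] m λ ys q →
    ≤-pred (≤∧≢⇒< (bound ys q) (λ eq → none (ys , eq , q)))

any-edge? : ∀ {Q : Pred (Edge n) 0ℓ} → Decidable Q → Dec (∃ Q)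
any-edge? Q? = map′ (λ (u , v , q) → (u , v) , q) (λ ((u , v) , q) → u , v , q)
                    (Fin.any? λ u → Fin.any? λ v → Q? (u , v))

module _ (G : Graph n) where

  adj? : ∀ u v → Dec (Adj G u v)
  adj? u v = T? (adj G u v)

  Adj-sym : ∀ {u v} → Adj G u v → Adj G v u
  Adj-sym {u} {v} = subst T (Graph.sym G u v)

  MatchingIn-resp-⊆ : ∀ {P} → MatchingIn G P Respects Sublist._⊇_
  MatchingIn-resp-⊆ M⊆M′ (edges , unique) = All-resp-⊆ M⊆M′ edges , Unique-resp-⊆ (endpoints-⊆ M⊆M′) unique

  MatchingIn-mono : ∀ {P Q : Pred (Fin n) 0ℓ} {M} → (∀ {v} → P v → Q v) → MatchingIn G P M → MatchingIn G Q M
  MatchingIn-mono P⇒Q (edges , unique) = All.map (λ (a , pu , pv) → a , P⇒Q pu , P⇒Q pv) edges , unique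

  matchingIn? : ∀ {P} → Decidable P → Decidable (MatchingIn G P)
  matchingIn? P? M = All.all? (λ (u , v) → adj? u v ×-dec P? u ×-dec P? v) M
                     ×-dec UniqueDec.unique? Fin._≟_ (endpoints M)

  maximumMatchingIn : ∀ {P} → Decidable P → Σ (List (Edge n)) (MaxMatchingIn G P)
  maximumMatchingIn P? = longest any-edge? (matchingIn? P?) ([] , []) n λ M (_ , unique) →
    subst (length M ≤_) (∣⊤∣≡n n) (length≤∣cover∣ ⊤ M unique (All.universal (λ _ → inj₁ ∈⊤) M))

  open Hall adj? using (SDR)

  module _ {X Y : Subset n} (s : SDR X Y) (X∩Y≡∅ : ∀ {v} → v ∈ X → v ∉ Y) where
    open SDR s

    private
      X∌Y : ∀ {v w} → v ∈ X → w ∈ Y → v ≢ w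
      X∌Y v∈X w∈Y refl = X∩Y≡∅ v∈X w∈Y

      edges : List (Fin n) → List (Edge n)
      edges = map (λ x → x , rep x)

      edges-unique : ∀ xs → Unique xs → All (_∈ X) xs → Unique (endpoints (edges xs))
      edges-unique []       []              []            = []
      edges-unique (x ∷ xs) (x∉xs ∷ unique) (x∈X ∷ xs⊆X) =
          (X∌Y x∈X (rep∈ x∈X) ∷ All-endpoints⁺ (All.map⁺ (All.zipWith x-fresh (x∉xs , xs⊆X))))
        ∷ All-endpoints⁺ (All.map⁺ (All.zipWith rep-fresh (x∉xs , xs⊆X)))
        ∷ edges-unique xs unique xs⊆X
        where
        x-fresh : ∀ {x′} → x ≢ x′ × x′ ∈ X → x ≢ x′ × x ≢ rep x′
        x-fresh (x≢x′ , x′∈X) = x≢x′ , X∌Y x∈X (rep∈ x′∈X)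
        rep-fresh : ∀ {x′} → x ≢ x′ × x′ ∈ X → rep x ≢ x′ × rep x ≢ rep x′
        rep-fresh (x≢x′ , x′∈X) = ≢-sym (X∌Y x′∈X (rep∈ x∈X)) , x≢x′ ∘ rep-injective x∈X x′∈X

    SDR⇒matching : Σ (List (Edge n)) λ M → MatchingIn G (λ v → v ∈ X ⊎ v ∈ Y) M × length M ≡ ∣ X ∣
    SDR⇒matching =
      edges (elements X) ,
      ( All.map⁺ (All.map (λ x∈X → R-rep x∈X , inj₁ x∈X , inj₂ (rep∈ x∈X)) (elements⊆ X))
      , edges-unique (elements X) (elements-unique X) (elements⊆ X)) ,
      trans (length-map _ (elements X)) (length-elements X)

  module _ {P : Pred (Fin n) 0ℓ} (P? : Decidable P) where

    touches? : Decidable (Touches P)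
    touches? (u , v) = P? u ⊎-dec P? v

    exchange : ∀ {M̂ M} → MatchingIn G P M̂ → MaxMatchingIn G AllV M →
               length (filter touches? M) ≤ length M̂ →
               MaxMatchingIn G AllV (M̂ ++ filter (¬? ∘ touches?) M)
    exchange {M̂} {M} (M̂-edges , M̂-unique) (M-matching , M-max) bound = matching , maximum
      where
      avoiding : List (Edge n)
      avoiding = filter (¬? ∘ touches?) M
      avoiding-matching : MatchingIn G AllV avoiding
      avoiding-matching = MatchingIn-resp-⊆ (filter-⊆ (¬? ∘ touches?) M) M-matching

      disjoint : Disjoint (endpoints M̂) (endpoints avoiding)
      disjoint (v∈M̂ , v∈avoiding) =
        All.lookup (All-endpoints⁺ (All.map (λ ¬touch → ¬touch ∘ inj₁ , ¬touch ∘ inj₂)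
                                            (all-filter (¬? ∘ touches?) M)))
                   v∈avoiding
                   (All.lookup (All-endpoints⁺ (All.map proj₂ M̂-edges)) v∈M̂)

      matching : MatchingIn G AllV (M̂ ++ avoiding)
      matching =
        All.++⁺ (All.map (λ (a , _) → a , tt , tt) M̂-edges) (proj₁ avoiding-matching) ,
        subst Unique (sym (endpoints-++ M̂ avoiding)) (Unique.++⁺ M̂-unique (proj₂ avoiding-matching) disjoint)

      maximum : ∀ M′ → MatchingIn G AllV M′ → length M′ ≤ length (M̂ ++ avoiding)
      maximum M′ M′-matching = begin
        length M′                                      ≤⟨ M-max M′ M′-matching ⟩
        length M                                       ≡⟨ sym (length-filter+length-filter-∁ touches? M) ⟩
        length (filter touches? M) + length avoiding   ≤⟨ +-monoˡ-≤ (length avoiding) bound ⟩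
        length M̂ + length avoiding                     ≡⟨ sym (length-++ M̂) ⟩
        length (M̂ ++ avoiding)                         ∎
        where open ≤-Reasoning

module Colouring (G : Graph n) (colour : Fin n → Bool) (proper : ∀ u v → Adj G u v → colour u ≢ colour v) where

  coloured? : Decidable (λ v → colour v ≡ true)
  coloured? v = colour v ≟ true

  C : Subset n
  C = ⟦ coloured? ⟧

  ∈C⇒true : ∀ {v} → v ∈ C → colour v ≡ true
  ∈C⇒true = ∈⟦⟧⁻ coloured?

  ∉C⇒false : ∀ {v} → v ∉ C → colour v ≡ false
  ∉C⇒false v∉C = ¬-not (v∉C ∘ ∈⟦⟧⁺ coloured?)

  monochromatic-stable : ∀ {B} → (∀ {u v} → u ∈ B → v ∈ B → colour u ≡ colour v) → Stable G B
  monochromatic-stable same u v u∈B v∈B adj = proper u v adj (same u∈B v∈B)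

  ∩C-stable : ∀ A → Stable G (A ∩ C)
  ∩C-stable A = monochromatic-stable λ u∈ v∈ →
    trans (∈C⇒true (proj₂ (x∈p∩q⁻ A C u∈))) (sym (∈C⇒true (proj₂ (x∈p∩q⁻ A C v∈))))

  ─C-stable : ∀ A → Stable G (A ─ C)
  ─C-stable A = monochromatic-stable λ u∈ v∈ →
    trans (∉C⇒false (x∈p─q⇒x∉q u∈)) (sym (∉C⇒false (x∈p─q⇒x∉q v∈)))

  no-common-neighbour : ∀ {x₁ x₂ y} → x₁ ∈ C → x₂ ∉ C → Adj G x₁ y → ¬ Adj G x₂ y
  no-common-neighbour {x₁} {x₂} {y} x₁∈C x₂∉C adj₁ adj₂ =
    proper x₂ y adj₂ (trans (∉C⇒false x₂∉C) (sym y-false))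
    where
    y-false : colour y ≡ false
    y-false = ¬-not (λ y-true → proper x₁ y adj₁ (trans (∈C⇒true x₁∈C) (sym y-true)))

module LocalMaximum {n} (G : Graph n) (S : Subset n) (S-lms : LocalMaxStable G S) where

  open Hall (adj? G)

  S-stable : Stable G S
  S-stable = proj₁ S-lms

  NS : Subset n
  NS = neighbours (∁ S) S

  closedNbhd? : Decidable (ClosedNbhd G S)
  closedNbhd? v = v ∈? S ⊎-dec Fin.any? (λ u → u ∈? S ×-dec adj? G u v)

  ∈NS⇒∉S : ∀ {v} → v ∈ NS → v ∉ S
  ∈NS⇒∉S v∈NS = x∈∁p⇒x∉p (proj₁ (∈neighbours⁻ v∈NS))

  NS⊆N[S] : ∀ {v} → v ∈ NS → ClosedNbhd G S v
  NS⊆N[S] v∈NS with _ , u , u∈S , adj ← ∈neighbours⁻ v∈NS = inj₂ (u , u∈S , adj)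

  ∈S∧Adj⇒∈NS : ∀ {u v} → u ∈ S → Adj G u v → v ∈ NS
  ∈S∧Adj⇒∈NS {u} {v} u∈S adj = ∈neighbours⁺ (x∉p⇒x∈∁p (λ v∈S → S-stable u v u∈S v∈S adj)) u∈S adj

  N[S]⊆S∪NS : ∀ {v} → ClosedNbhd G S v → v ∈ S ⊎ v ∈ NS
  N[S]⊆S∪NS (inj₁ v∈S)             = inj₁ v∈S
  N[S]⊆S∪NS (inj₂ (_ , u∈S , adj)) = inj₂ (∈S∧Adj⇒∈NS u∈S adj)

  touching-edge-meets-NS : ∀ e → Adj G (proj₁ e) (proj₂ e) → Touches (ClosedNbhd G S) e → Touches (_∈ NS) e
  touching-edge-meets-NS (u , v) adj (inj₁ u∈N[S]) with N[S]⊆S∪NS u∈N[S]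
  ... | inj₁ u∈S  = inj₂ (∈S∧Adj⇒∈NS u∈S adj)
  ... | inj₂ u∈NS = inj₁ u∈NS
  touching-edge-meets-NS (u , v) adj (inj₂ v∈N[S]) with N[S]⊆S∪NS v∈N[S]
  ... | inj₁ v∈S  = inj₁ (∈S∧Adj⇒∈NS v∈S (Adj-sym G adj))
  ... | inj₂ v∈NS = inj₂ v∈NS

  stable-expands : ∀ {A} → A ⊆ NS → Stable G A → ∣ A ∣ ≤ ∣ neighbours S A ∣
  stable-expands {A} A⊆NS A-stable = +-cancelʳ-≤ _ _ _ (begin
    ∣ A ∣ + ∣ S ─ NA ∣        ≡⟨ sym (∣p∪q∣≡∣p∣+∣q∣ A (S ─ NA) (λ x∈A → ∈NS⇒∉S (A⊆NS x∈A) ∘ p─q⊆p S NA)) ⟩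
    ∣ T′ ∣                    ≤⟨ proj₂ S-lms T′ (λ _ → T′⊆N[S]) T′-stable ⟩
    ∣ S ∣                     ≡⟨ ∣p∣≡∣p∩q∣+∣p─q∣ S NA ⟩
    ∣ S ∩ NA ∣ + ∣ S ─ NA ∣   ≤⟨ +-monoˡ-≤ _ (∣p∩q∣≤∣q∣ S NA) ⟩
    ∣ NA ∣ + ∣ S ─ NA ∣       ∎)
    where
    open ≤-Reasoning
    NA T′ : Subset n
    NA = neighbours S A
    T′ = A ∪ (S ─ NA)

    T′⊆N[S] : ∀ {v} → v ∈ T′ → ClosedNbhd G S v
    T′⊆N[S] v∈T′ = Sum.[ NS⊆N[S] ∘ A⊆NS , inj₁ ∘ p─q⊆p S NA ] (x∈p∪q⁻ A (S ─ NA) v∈T′)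

    no-edge-A-S─NA : ∀ {u v} → u ∈ A → v ∈ S ─ NA → ¬ Adj G u v
    no-edge-A-S─NA u∈A v∈S─NA adj = x∈p─q⇒x∉q v∈S─NA (∈neighbours⁺ (p─q⊆p S NA v∈S─NA) u∈A adj)

    T′-stable : Stable G T′
    T′-stable u v u∈T′ v∈T′ adj with x∈p∪q⁻ A (S ─ NA) u∈T′ | x∈p∪q⁻ A (S ─ NA) v∈T′
    ... | inj₁ u∈A | inj₁ v∈A = A-stable u v u∈A v∈A adj
    ... | inj₁ u∈A | inj₂ v∈S = no-edge-A-S─NA u∈A v∈S adj
    ... | inj₂ u∈S | inj₁ v∈A = no-edge-A-S─NA v∈A u∈S (Adj-sym G adj)
    ... | inj₂ u∈S | inj₂ v∈S = S-stable u v (p─q⊆p S NA u∈S) (p─q⊆p S NA v∈S) adj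

  hallCondition : Bipartite G → HallCondition NS S
  hallCondition (colour , proper) A A⊆NS = begin
    ∣ A ∣                  ≡⟨ ∣p∣≡∣p∩q∣+∣p─q∣ A C ⟩
    ∣ A ∩ C ∣ + ∣ A ─ C ∣  ≤⟨ +-mono-≤ (stable-expands (A⊆NS ∘ p∩q⊆p A C) (∩C-stable A))
                                       (stable-expands (A⊆NS ∘ p─q⊆p A C) (─C-stable A)) ⟩
    ∣ N₁ ∣ + ∣ N₂ ∣        ≡⟨ sym (∣p∪q∣≡∣p∣+∣q∣ N₁ N₂ N₁∩N₂≡∅) ⟩
    ∣ N₁ ∪ N₂ ∣            ≤⟨ p⊆q⇒∣p∣≤∣q∣ (p⊆r∧q⊆r⇒p∪q⊆r N₁ N₂ (neighbours-mono (p∩q⊆p A C))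
                                                               (neighbours-mono (p─q⊆p A C))) ⟩
    ∣ neighbours S A ∣     ∎
    where
    open ≤-Reasoning
    open Colouring G colour proper

    N₁ N₂ : Subset n
    N₁ = neighbours S (A ∩ C)
    N₂ = neighbours S (A ─ C)

    N₁∩N₂≡∅ : ∀ {y} → y ∈ N₁ → y ∉ N₂
    N₁∩N₂≡∅ y∈N₁ y∈N₂
      with _ , _ , x₁∈ , adj₁ ← ∈neighbours⁻ y∈N₁
         | _ , _ , x₂∈ , adj₂ ← ∈neighbours⁻ y∈N₂ =
      no-common-neighbour (proj₂ (x∈p∩q⁻ A C x₁∈)) (x∈p─q⇒x∉q x₂∈) adj₁ adj₂

  ∣NS∣≤∣M̂∣ : Bipartite G → ∀ {M̂} → MaxMatchingIn G (ClosedNbhd G S) M̂ → ∣ NS ∣ ≤ length M̂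
  ∣NS∣≤∣M̂∣ bipartite (_ , M̂-max)
    with M , M-matching , ∣M∣≡∣NS∣ ← SDR⇒matching G (hall (hallCondition bipartite)) ∈NS⇒∉S =
    subst (_≤ _) ∣M∣≡∣NS∣ (M̂-max M (MatchingIn-mono G Sum.[ NS⊆N[S] , inj₁ ] M-matching))

  ∣touching∣≤∣NS∣ : ∀ {M} → MatchingIn G AllV M → length (filter (touches? G closedNbhd?) M) ≤ ∣ NS ∣
  ∣touching∣≤∣NS∣ {M} M-matching =
    length≤∣cover∣ NS touching (proj₂ touching-matching)
      (All.zipWith (λ {e} ((adj , _) , touch) → touching-edge-meets-NS e adj touch)
                   (proj₁ touching-matching , all-filter (touches? G closedNbhd?) M))
    where
    touching : List (Edge n)
    touching = filter (touches? G closedNbhd?) M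
    touching-matching : MatchingIn G AllV touching
    touching-matching = MatchingIn-resp-⊆ G (filter-⊆ (touches? G closedNbhd?) M) M-matching

lemma3 : ∀ {n : ℕ} (G : Graph n) → Bipartite G →
    (S : Subset n) → LocalMaxStable G S →
    (M̂ : List (Edge n)) → MaxMatchingIn G (ClosedNbhd G S) M̂ →
    Σ (List (Edge n)) λ M → MaxMatchingIn G AllV M × M̂ ⊆E M
lemma3 G bipartite S S-lms M̂ M̂-max@(M̂-matching , _)
  with M , M-max@(M-matching , _) ← maximumMatchingIn G {AllV} (λ _ → yes tt) =
  M̂ ++ filter (¬? ∘ touches? G closedNbhd?) M ,
  exchange G closedNbhd? M̂-matching M-max (≤-trans (∣touching∣≤∣NS∣ M-matching) (∣NS∣≤∣M̂∣ bipartite M̂-max)) ,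
  All.tabulate λ { {_ , _} e∈M̂ → inj₁ (∈-++⁺ˡ e∈M̂) }
  where open LocalMaximum G S S-lms
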